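{- Let $G$ and $H$ be graphs, each of order at least $2$, and let $k$ be a positive integer with $k\le\mathcal{C}(G+H)$. The following are equivalent: (i) there exist a $k$-adjacency basis $A_G$ of $G$ and a $k$-adjacency basis $A_H$ of $H$ such that $|(A_G\setminus N_G(x))\cup(A_H\setminus N_H(y))|\ge k$ for all $x\in V(G)$ and $y\in V(H)$; (ii) $\operatorname{adim}_k(G+H)=\operatorname{adim}_k(G)+\operatorname{adim}_k(H)$.
   Context: All graphs are finite and simple; $N_G(x)$ is the open neighbourhood of $x$ in $G$. The join $G+H$ of vertex-disjoint graphs has vertex set $V(G)\cup V(H)$ and edges $E(G)\cup E(H)\cup\{uv:u\in V(G),v\in V(H)\}$. For a graph $G=(V,E)$, $d_{G,2}(x,y)=\min\{d_G(x,y),2\}$ with $d_G$ the shortest-path distance ($\infty$ between different components). For distinct $x,y$, $\mathcal{C}_G(x,y)=\{z\in V: d_{G,2}(x,z)\ne d_{G,2}(y,z)\}$, $\mathcal{C}(G)=\min_{x\ne y}|\mathcal{C}_G(x,y)|$. A set $S\subseteq V$ is a $k$-adjacency generator if $|S\cap\mathcal{C}_G(x,y)|\ge k$ for all distinct $x,y$; a minimum one is a $k$-adjacency basis, of cardinality $\operatorname{adim}_k(G)$. -}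

module Defs where

open import Data.Nat using (ℕ; _+_; _≤_)
open import Data.Bool using (Bool; true; false; if_then_else_)
open import Data.Fin using (Fin; splitAt)
open import Data.Fin.Subset using (Subset; ∣_∣; _∩_; _∪_; _─_; ⊥; inside; outside)
open import Data.Vec using (tabulate; _++_)
open import Data.Sum using (_⊎_; inj₁; inj₂)
open import Data.Product using (Σ; _×_)
open import Relation.Binary.PropositionalEquality using (_≡_; _≢_; refl)
open import Relation.Nullary using (yes; no)
open import Data.Fin using (_≟_)

record Graph : Set where
  field
    order  : ℕ
    Adj    : Fin order → Fin order → Bool
    sym    : ∀ x y → Adj x y ≡ Adj y x
    irrefl : ∀ x → Adj x x ≡ false
open Graph public

N : (G : Graph) → Fin (order G) → Subset (order G)
N G x = tabulate (λ z → Adj G x z)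

-- Truncated distance d_{G,2}(x,z) = min{d_G(x,z), 2} written out:
-- 0 if x = z, 1 if adjacent, 2 otherwise (distance ≥ 2 or ∞).
d2 : (G : Graph) → Fin (order G) → Fin (order G) → ℕ
d2 G x z with x ≟ z
... | yes _ = 0
... | no _  = if Adj G x z then 1 else 2

distinguish : (G : Graph) → Fin (order G) → Fin (order G) → Subset (order G)
distinguish G x y = tabulate (λ z → neq (d2 G x z) (d2 G y z))
  where
  open import Data.Nat using (_≡ᵇ_)
  open import Data.Bool using (not)
  neq : ℕ → ℕ → Bool
  neq a b = not (a ≡ᵇ b)

-- k ≤ 𝒞(G), where 𝒞(G) = min over distinct x,y of |𝒞_G(x,y)|.
_≤𝒞_ : ℕ → Graph → Set
k ≤𝒞 G = ∀ (x y : Fin (order G)) → x ≢ y → k ≤ ∣ distinguish G x y ∣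

IsGenerator : ℕ → (G : Graph) → Subset (order G) → Set
IsGenerator k G S = ∀ (x y : Fin (order G)) → x ≢ y → k ≤ ∣ S ∩ distinguish G x y ∣

IsBasis : ℕ → (G : Graph) → Subset (order G) → Set
IsBasis k G S = IsGenerator k G S × (∀ S′ → IsGenerator k G S′ → ∣ S ∣ ≤ ∣ S′ ∣)

IsAdim : ℕ → (G : Graph) → ℕ → Set
IsAdim k G m = Σ (Subset (order G)) (λ S → IsBasis k G S × ∣ S ∣ ≡ m)

-- Join G + H on vertex set Fin (order G + order H):
-- first order G vertices are G, the rest are H.
module _ (G H : Graph) where
  private
    jadj : Fin (order G) ⊎ Fin (order H) → Fin (order G) ⊎ Fin (order H) → Bool
    jadj (inj₁ a) (inj₁ b) = Adj G a b
    jadj (inj₂ a) (inj₂ b) = Adj H a b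
    jadj (inj₁ _) (inj₂ _) = true
    jadj (inj₂ _) (inj₁ _) = true

    jsym : ∀ u v → jadj u v ≡ jadj v u
    jsym (inj₁ a) (inj₁ b) = sym G a b
    jsym (inj₂ a) (inj₂ b) = sym H a b
    jsym (inj₁ _) (inj₂ _) = refl
    jsym (inj₂ _) (inj₁ _) = refl

    jirr : ∀ u → jadj u u ≡ false
    jirr (inj₁ a) = irrefl G a
    jirr (inj₂ a) = irrefl H a

  _⊕_ : Graph
  _⊕_ = record
    { order  = order G + order H
    ; Adj    = λ x y → jadj (splitAt (order G) x) (splitAt (order G) y)
    ; sym    = λ x y → jsym (splitAt (order G) x) (splitAt (order G) y)
    ; irrefl = λ x → jirr (splitAt (order G) x)
    }

embedˡ : ∀ {m} n → Subset m → Subset (m + n)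
embedˡ n S = S ++ ⊥

embedʳ : ∀ m {n} → Subset n → Subset (m + n)
embedʳ m S = ⊥ {m} ++ S

-- In G ⊕ H every vertex of G is adjacent to every vertex of H. Hence two vertices of G are
-- distinguished exactly by the vertices of G that distinguish them in G (likewise for H), and
-- x ∈ V(G), y ∈ V(H) exactly by the vertices outside N_G(x) ∪ N_H(y). So S_G ∪ S_H is a
-- k-adjacency generator of G ⊕ H iff S_G and S_H are generators of G and H satisfying the cross
-- condition of (i). Every generator of G ⊕ H thus has at least adim_k G + adim_k H elements, and
-- (i) says precisely that this bound is attained by a basis of G ⊕ H.
module Submission where

open import Defs
open import Data.Nat using (ℕ; _+_; _≤_; _<_)
open import Data.Fin using (Fin)
open import Data.Fin.Subset using (Subset; ∣_∣; _∪_; _─_)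
open import Data.Product using (Σ; _×_)
open import Function.Bundles using (_⇔_)
open import Relation.Binary.PropositionalEquality using (_≡_)

open import Data.Bool using (Bool; true; false; not; if_then_else_; _∧_; _∨_)
open import Data.Bool.Properties using (∧-zeroʳ; ∧-identityʳ)
open import Data.Nat using (zero; suc; _≡ᵇ_; _≤?_; _<?_; z≤n)
open import Data.Nat.Properties
  using (≤-trans; ≤-antisym; ≤-reflexive; ≤-pred; ≮⇒≥; +-comm; +-mono-≤; +-monoʳ-≤; +-cancelʳ-≤; +-identityʳ)
open import Data.Fin as Fin using (_↑ˡ_; _↑ʳ_; splitAt; _≟_)
open import Data.Fin.Properties using (all?; splitAt-↑ˡ; splitAt-↑ʳ; ↑ˡ-injective; ↑ʳ-injective; join-splitAt)
open import Data.Fin.Subset using (⊥; ⊤; _∩_; ∁; inside; outside)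
open import Data.Fin.Subset.Properties using (anySubset?; ∣⊥∣≡0; ∣p∣≤n; ∩-zeroʳ; ∩-identityˡ; ∪-identityʳ; ∪-identityˡ)
open import Data.Product using (_,_; proj₁; proj₂; Σ-syntax)
open import Data.Sum using (inj₁; inj₂)
open import Data.Vec as Vec using ([]; _∷_; tabulate; _++_; replicate)
open import Data.Vec.Properties using (tabulate-cong; tabulate-∘; map-const; zipWith-++)
open import Function using (_∘_; const; id)
open import Function.Bundles using (Equivalence; mk⇔)
open import Relation.Binary.PropositionalEquality as ≡
  using (refl; trans; cong; cong₂; subst; _≢_; module ≡-Reasoning)
open import Relation.Nullary using (yes; no; ¬?; contradiction)
open import Relation.Nullary.Decidable using (_×-dec_; _→-dec_)
open import Relation.Unary using (Decidable)

∣p++q∣≡∣p∣+∣q∣ : ∀ {m n} (p : Subset m) (q : Subset n) → ∣ p ++ q ∣ ≡ ∣ p ∣ + ∣ q ∣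
∣p++q∣≡∣p∣+∣q∣ []            q = refl
∣p++q∣≡∣p∣+∣q∣ (outside ∷ p) q = ∣p++q∣≡∣p∣+∣q∣ p q
∣p++q∣≡∣p∣+∣q∣ (inside  ∷ p) q = cong suc (∣p++q∣≡∣p∣+∣q∣ p q)

∣p++⊥∣≡∣p∣ : ∀ {m} n (p : Subset m) → ∣ p ++ ⊥ {n} ∣ ≡ ∣ p ∣
∣p++⊥∣≡∣p∣ n p = begin
  ∣ p ++ ⊥ ∣         ≡⟨ ∣p++q∣≡∣p∣+∣q∣ p (⊥ {n}) ⟩
  ∣ p ∣ + ∣ ⊥ {n} ∣  ≡⟨ cong (∣ p ∣ +_) (∣⊥∣≡0 n) ⟩
  ∣ p ∣ + 0          ≡⟨ +-identityʳ ∣ p ∣ ⟩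
  ∣ p ∣              ∎
  where open ≡-Reasoning

∣⊥++p∣≡∣p∣ : ∀ m {n} (p : Subset n) → ∣ ⊥ {m} ++ p ∣ ≡ ∣ p ∣
∣⊥++p∣≡∣p∣ m p = trans (∣p++q∣≡∣p∣+∣q∣ (⊥ {m}) p) (cong (_+ ∣ p ∣) (∣⊥∣≡0 m))

∩-++ : ∀ {m n} (p r : Subset m) (q s : Subset n) → (p ++ q) ∩ (r ++ s) ≡ (p ∩ r) ++ (q ∩ s)
∩-++ p r q s = zipWith-++ _∧_ p q r s

embedˡ-∪-embedʳ : ∀ {m n} (p : Subset m) (q : Subset n) → embedˡ n p ∪ embedʳ m q ≡ p ++ q
embedˡ-∪-embedʳ p q = trans (zipWith-++ _∨_ p ⊥ ⊥ q) (cong₂ _++_ (∪-identityʳ p) (∪-identityˡ q))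

p∩∁q≡p─q : ∀ {n} (p q : Subset n) → p ∩ ∁ q ≡ p ─ q
p∩∁q≡p─q []      []            = refl
p∩∁q≡p─q (x ∷ p) (inside  ∷ q) = cong₂ _∷_ (∧-zeroʳ x) (p∩∁q≡p─q p q)
p∩∁q≡p─q (x ∷ p) (outside ∷ q) = cong₂ _∷_ (∧-identityʳ x) (p∩∁q≡p─q p q)

tabulate-const : ∀ {A : Set} n (a : A) → tabulate {n = n} (const a) ≡ replicate n a
tabulate-const n a = trans (tabulate-∘ (const a) id) (map-const (tabulate id) a)

tabulate-+ : ∀ {A : Set} m n (f : Fin (m + n) → A) →
             tabulate f ≡ tabulate (f ∘ (_↑ˡ n)) ++ tabulate (f ∘ (m ↑ʳ_))
tabulate-+ zero    n f = refl
tabulate-+ (suc m) n f = cong (f Fin.zero ∷_) (tabulate-+ m n (f ∘ Fin.suc))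

_≢ᵇ_ : ℕ → ℕ → Bool
a ≢ᵇ b = not (a ≡ᵇ b)

≡ᵇ-comm : ∀ a b → (a ≡ᵇ b) ≡ (b ≡ᵇ a)
≡ᵇ-comm zero    zero    = refl
≡ᵇ-comm zero    (suc b) = refl
≡ᵇ-comm (suc a) zero    = refl
≡ᵇ-comm (suc a) (suc b) = ≡ᵇ-comm a b

adjacent⇒distinct : ∀ K {x z} → Adj K x z ≡ true → x ≢ z
adjacent⇒distinct K {x} xz refl with trans (≡.sym xz) (irrefl K x)
... | ()

d2-self : ∀ K x → d2 K x x ≡ 0
d2-self K x with x ≟ x
... | yes _   = refl
... | no x≢x = contradiction refl x≢x

d2-distinct : ∀ K {x z} → x ≢ z → d2 K x z ≡ (if Adj K x z then 1 else 2)
d2-distinct K {x} {z} x≢z with x ≟ z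
... | yes x≡z = contradiction x≡z x≢z
... | no _    = refl

d2-adjacent : ∀ K {x z} → Adj K x z ≡ true → d2 K x z ≡ 1
d2-adjacent K xz = trans (d2-distinct K (adjacent⇒distinct K xz)) (cong (λ b → if b then 1 else 2) xz)

d2≡ᵇ1 : ∀ K x z → (d2 K x z ≡ᵇ 1) ≡ Adj K x z
d2≡ᵇ1 K x z with x ≟ z
... | yes refl = ≡.sym (irrefl K x)
... | no _ with Adj K x z
...   | true  = refl
...   | false = refl

d2-embedding : ∀ K L (f : Fin (order K) → Fin (order L)) → (∀ {x z} → f x ≡ f z → x ≡ z) →
               (∀ x z → Adj L (f x) (f z) ≡ Adj K x z) → ∀ x z → d2 L (f x) (f z) ≡ d2 K x z
d2-embedding K L f f-injective f-adj x z with x ≟ z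
... | yes refl = d2-self L (f x)
... | no x≢z   = trans (d2-distinct L (x≢z ∘ f-injective)) (cong (λ b → if b then 1 else 2) (f-adj x z))

distinguish-comm : ∀ K x y → distinguish K x y ≡ distinguish K y x
distinguish-comm K x y = tabulate-cong λ z → cong not (≡ᵇ-comm (d2 K x z) (d2 K y z))

isGenerator? : ∀ k K → Decidable (IsGenerator k K)
isGenerator? k K S = all? λ x → all? λ y → ¬? (x ≟ y) →-dec k ≤? ∣ S ∩ distinguish K x y ∣

≤𝒞⇒⊤-isGenerator : ∀ {k} K → k ≤𝒞 K → IsGenerator k K ⊤
≤𝒞⇒⊤-isGenerator {k} K k≤𝒞 x y x≢y =
  subst (k ≤_) (cong ∣_∣ (≡.sym (∩-identityˡ (distinguish K x y)))) (k≤𝒞 x y x≢y)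

minimal-subset : ∀ {n} (P : Subset n → Set) → Decidable P → ∀ S → P S →
                 Σ[ M ∈ Subset n ] P M × (∀ T → P T → ∣ M ∣ ≤ ∣ T ∣)
minimal-subset {n} P P? S pS = descend n S (∣p∣≤n S) pS
  where
  descend : ∀ b S → ∣ S ∣ ≤ b → P S → Σ[ M ∈ Subset n ] P M × (∀ T → P T → ∣ M ∣ ≤ ∣ T ∣)
  descend zero    S ∣S∣≤0 pS = S , pS , λ T _ → ≤-trans ∣S∣≤0 z≤n
  descend (suc b) S ∣S∣≤b pS with anySubset? (λ T → P? T ×-dec ∣ T ∣ <? ∣ S ∣)
  ... | yes (T , pT , ∣T∣<∣S∣) = descend b T (≤-pred (≤-trans ∣T∣<∣S∣ ∣S∣≤b)) pT
  ... | no ∄smaller           = S , pS , λ T pT → ≮⇒≥ λ ∣T∣<∣S∣ → ∄smaller (T , pT , ∣T∣<∣S∣)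

basis-exists : ∀ {k} K S → IsGenerator k K S → Σ (Subset (order K)) (IsBasis k K)
basis-exists {k} K = minimal-subset (IsGenerator k K) (isGenerator? k K)

basis-size-unique : ∀ {k} K A B → IsBasis k K A → IsBasis k K B → ∣ A ∣ ≡ ∣ B ∣
basis-size-unique K A B (gA , minA) (gB , minB) = ≤-antisym (minA B gB) (minB A gA)

isGenerator-≤-basis⇒basis : ∀ {k} K S B → IsBasis k K B → IsGenerator k K S → ∣ S ∣ ≤ ∣ B ∣ → IsBasis k K S
isGenerator-≤-basis⇒basis K S B (_ , minB) gS ∣S∣≤∣B∣ = gS , λ T gT → ≤-trans ∣S∣≤∣B∣ (minB T gT)

m+n≡o+p∧p≤n⇒m≤o : ∀ {m n o p} → m + n ≡ o + p → p ≤ n → m ≤ o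
m+n≡o+p∧p≤n⇒m≤o {m} {n} {o} {p} eq p≤n = +-cancelʳ-≤ p m o (≤-trans (+-monoʳ-≤ m p≤n) (≤-reflexive eq))

module Join (G H : Graph) where

  m n : ℕ
  m = order G
  n = order H

  GH : Graph
  GH = G ⊕ H

  data JoinVertex : Fin (m + n) → Set where
    inl : ∀ i → JoinVertex (i ↑ˡ n)
    inr : ∀ j → JoinVertex (m ↑ʳ j)

  joinVertex : ∀ u → JoinVertex u
  joinVertex u with splitAt m u | join-splitAt m n u
  ... | inj₁ i | refl = inl i
  ... | inj₂ j | refl = inr j

  adj-inl : ∀ i i' → Adj GH (i ↑ˡ n) (i' ↑ˡ n) ≡ Adj G i i'
  adj-inl i i' rewrite splitAt-↑ˡ m i n | splitAt-↑ˡ m i' n = refl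

  adj-inr : ∀ j j' → Adj GH (m ↑ʳ j) (m ↑ʳ j') ≡ Adj H j j'
  adj-inr j j' rewrite splitAt-↑ʳ m n j | splitAt-↑ʳ m n j' = refl

  adj-inl-inr : ∀ i j → Adj GH (i ↑ˡ n) (m ↑ʳ j) ≡ true
  adj-inl-inr i j rewrite splitAt-↑ˡ m i n | splitAt-↑ʳ m n j = refl

  d2-inl : ∀ i i' → d2 GH (i ↑ˡ n) (i' ↑ˡ n) ≡ d2 G i i'
  d2-inl = d2-embedding G GH (_↑ˡ n) (↑ˡ-injective n _ _) adj-inl

  d2-inr : ∀ j j' → d2 GH (m ↑ʳ j) (m ↑ʳ j') ≡ d2 H j j'
  d2-inr = d2-embedding H GH (m ↑ʳ_) (↑ʳ-injective m _ _) adj-inr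

  d2-inl-inr : ∀ i j → d2 GH (i ↑ˡ n) (m ↑ʳ j) ≡ 1
  d2-inl-inr i j = d2-adjacent GH (adj-inl-inr i j)

  d2-inr-inl : ∀ j i → d2 GH (m ↑ʳ j) (i ↑ˡ n) ≡ 1
  d2-inr-inl j i = d2-adjacent GH (trans (sym GH _ _) (adj-inl-inr i j))

  distinguish-inl : ∀ i i' → distinguish GH (i ↑ˡ n) (i' ↑ˡ n) ≡ distinguish G i i' ++ ⊥
  distinguish-inl i i' = trans (tabulate-+ m n _) (cong₂ _++_
    (tabulate-cong λ z → cong₂ _≢ᵇ_ (d2-inl i z) (d2-inl i' z))
    (trans (tabulate-cong λ z → cong₂ _≢ᵇ_ (d2-inl-inr i z) (d2-inl-inr i' z)) (tabulate-const n false)))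

  distinguish-inr : ∀ j j' → distinguish GH (m ↑ʳ j) (m ↑ʳ j') ≡ ⊥ ++ distinguish H j j'
  distinguish-inr j j' = trans (tabulate-+ m n _) (cong₂ _++_
    (trans (tabulate-cong λ z → cong₂ _≢ᵇ_ (d2-inr-inl j z) (d2-inr-inl j' z)) (tabulate-const m false))
    (tabulate-cong λ z → cong₂ _≢ᵇ_ (d2-inr j z) (d2-inr j' z)))

  -- Both i and j are at distance 1 from the other side, so a vertex z is in 𝒞(i, j) iff it is not
  -- adjacent to whichever of i, j lies on its own side.
  distinguish-inl-inr : ∀ i j → distinguish GH (i ↑ˡ n) (m ↑ʳ j) ≡ ∁ (N G i) ++ ∁ (N H j)
  distinguish-inl-inr i j = trans (tabulate-+ m n _) (cong₂ _++_
    (trans (tabulate-cong λ z → trans (cong₂ _≢ᵇ_ (d2-inl i z) (d2-inr-inl j z)) (cong not (d2≡ᵇ1 G i z)))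
           (tabulate-∘ not (Adj G i)))
    (trans (tabulate-cong λ z → trans (cong₂ _≢ᵇ_ (d2-inl-inr i z) (d2-inr j z))
                                      (cong not (trans (≡ᵇ-comm 1 (d2 H j z)) (d2≡ᵇ1 H j z))))
           (tabulate-∘ not (Adj H j))))

  CrossCondition : ℕ → Subset m → Subset n → Set
  CrossCondition k SG SH = ∀ x y → k ≤ ∣ embedˡ n (SG ─ N G x) ∪ embedʳ m (SH ─ N H y) ∣

  module _ (SG : Subset m) (SH : Subset n) where
    open ≡-Reasoning

    ∣∩distinguish-inl∣ : ∀ i i' → ∣ (SG ++ SH) ∩ distinguish GH (i ↑ˡ n) (i' ↑ˡ n) ∣ ≡ ∣ SG ∩ distinguish G i i' ∣
    ∣∩distinguish-inl∣ i i' = begin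
      ∣ (SG ++ SH) ∩ distinguish GH (i ↑ˡ n) (i' ↑ˡ n) ∣  ≡⟨ cong (λ D → ∣ (SG ++ SH) ∩ D ∣) (distinguish-inl i i') ⟩
      ∣ (SG ++ SH) ∩ (distinguish G i i' ++ ⊥) ∣          ≡⟨ cong ∣_∣ (∩-++ SG (distinguish G i i') SH ⊥) ⟩
      ∣ (SG ∩ distinguish G i i') ++ (SH ∩ ⊥) ∣           ≡⟨ cong (λ q → ∣ (SG ∩ distinguish G i i') ++ q ∣) (∩-zeroʳ SH) ⟩
      ∣ (SG ∩ distinguish G i i') ++ ⊥ {n} ∣              ≡⟨ ∣p++⊥∣≡∣p∣ n (SG ∩ distinguish G i i') ⟩
      ∣ SG ∩ distinguish G i i' ∣                         ∎

    ∣∩distinguish-inr∣ : ∀ j j' → ∣ (SG ++ SH) ∩ distinguish GH (m ↑ʳ j) (m ↑ʳ j') ∣ ≡ ∣ SH ∩ distinguish H j j' ∣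
    ∣∩distinguish-inr∣ j j' = begin
      ∣ (SG ++ SH) ∩ distinguish GH (m ↑ʳ j) (m ↑ʳ j') ∣  ≡⟨ cong (λ D → ∣ (SG ++ SH) ∩ D ∣) (distinguish-inr j j') ⟩
      ∣ (SG ++ SH) ∩ (⊥ ++ distinguish H j j') ∣          ≡⟨ cong ∣_∣ (∩-++ SG ⊥ SH (distinguish H j j')) ⟩
      ∣ (SG ∩ ⊥) ++ (SH ∩ distinguish H j j') ∣           ≡⟨ cong (λ p → ∣ p ++ (SH ∩ distinguish H j j') ∣) (∩-zeroʳ SG) ⟩
      ∣ ⊥ {m} ++ (SH ∩ distinguish H j j') ∣              ≡⟨ ∣⊥++p∣≡∣p∣ m (SH ∩ distinguish H j j') ⟩
      ∣ SH ∩ distinguish H j j' ∣                         ∎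

    ∣∩distinguish-inl-inr∣ : ∀ i j → ∣ (SG ++ SH) ∩ distinguish GH (i ↑ˡ n) (m ↑ʳ j) ∣
                                   ≡ ∣ embedˡ n (SG ─ N G i) ∪ embedʳ m (SH ─ N H j) ∣
    ∣∩distinguish-inl-inr∣ i j = cong ∣_∣ (begin
      (SG ++ SH) ∩ distinguish GH (i ↑ˡ n) (m ↑ʳ j)      ≡⟨ cong ((SG ++ SH) ∩_) (distinguish-inl-inr i j) ⟩
      (SG ++ SH) ∩ (∁ (N G i) ++ ∁ (N H j))              ≡⟨ ∩-++ SG (∁ (N G i)) SH (∁ (N H j)) ⟩
      (SG ∩ ∁ (N G i)) ++ (SH ∩ ∁ (N H j))               ≡⟨ cong₂ _++_ (p∩∁q≡p─q SG _) (p∩∁q≡p─q SH _) ⟩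
      (SG ─ N G i) ++ (SH ─ N H j)                       ≡⟨ embedˡ-∪-embedʳ (SG ─ N G i) (SH ─ N H j) ⟨
      embedˡ n (SG ─ N G i) ∪ embedʳ m (SH ─ N H j)      ∎)

  isGenerator-⊕⇔ : ∀ k SG SH → IsGenerator k GH (SG ++ SH) ⇔
                   (IsGenerator k G SG × IsGenerator k H SH × CrossCondition k SG SH)
  isGenerator-⊕⇔ k SG SH = mk⇔ restrict glue
    where
    restrict : IsGenerator k GH (SG ++ SH) → IsGenerator k G SG × IsGenerator k H SH × CrossCondition k SG SH
    restrict g =
        (λ i i' i≢i' → subst (k ≤_) (∣∩distinguish-inl∣ SG SH i i') (g _ _ (i≢i' ∘ ↑ˡ-injective n i i')))
      , (λ j j' j≢j' → subst (k ≤_) (∣∩distinguish-inr∣ SG SH j j') (g _ _ (j≢j' ∘ ↑ʳ-injective m j j')))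
      , (λ i j → subst (k ≤_) (∣∩distinguish-inl-inr∣ SG SH i j) (g _ _ (adjacent⇒distinct GH (adj-inl-inr i j))))

    glue : IsGenerator k G SG × IsGenerator k H SH × CrossCondition k SG SH → IsGenerator k GH (SG ++ SH)
    glue (gG , gH , cross) u v u≢v with joinVertex u | joinVertex v
    ... | inl i | inl i' = subst (k ≤_) (≡.sym (∣∩distinguish-inl∣ SG SH i i')) (gG i i' (u≢v ∘ cong (_↑ˡ n)))
    ... | inr j | inr j' = subst (k ≤_) (≡.sym (∣∩distinguish-inr∣ SG SH j j')) (gH j j' (u≢v ∘ cong (m ↑ʳ_)))
    ... | inl i | inr j  = subst (k ≤_) (≡.sym (∣∩distinguish-inl-inr∣ SG SH i j)) (cross i j)
    ... | inr j | inl i  = subst (k ≤_)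
      (trans (≡.sym (∣∩distinguish-inl-inr∣ SG SH i j))
             (cong (λ D → ∣ (SG ++ SH) ∩ D ∣) (distinguish-comm GH (i ↑ˡ n) (m ↑ʳ j))))
      (cross i j)

  basis-sum-≤-isGenerator : ∀ {k} BG BH T → IsBasis k G BG → IsBasis k H BH → IsGenerator k GH T →
                            ∣ BG ∣ + ∣ BH ∣ ≤ ∣ T ∣
  basis-sum-≤-isGenerator {k} BG BH T (_ , minG) (_ , minH) gT with Vec.splitAt m T
  ... | TG , TH , refl with Equivalence.to (isGenerator-⊕⇔ k TG TH) gT
  ... | gG , gH , _ = ≤-trans (+-mono-≤ (minG TG gG) (minH TH gH)) (≤-reflexive (≡.sym (∣p++q∣≡∣p∣+∣q∣ TG TH)))

  ++-basis : ∀ {k} AG AH → IsBasis k G AG → IsBasis k H AH → CrossCondition k AG AH → IsBasis k GH (AG ++ AH)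
  ++-basis {k} AG AH bG bH cross =
      Equivalence.from (isGenerator-⊕⇔ k AG AH) (proj₁ bG , proj₁ bH , cross)
    , λ T gT → subst (_≤ ∣ T ∣) (≡.sym (∣p++q∣≡∣p∣+∣q∣ AG AH)) (basis-sum-≤-isGenerator AG AH T bG bH gT)

  GluedBases : ℕ → Set
  GluedBases k = Σ (Subset m) λ AG → Σ (Subset n) λ AH → IsBasis k G AG × IsBasis k H AH × CrossCondition k AG AH

  AdimAdditive : ℕ → Set
  AdimAdditive k = ∀ a b c → IsAdim k G a → IsAdim k H b → IsAdim k GH c → c ≡ a + b

  gluedBases⇒adimAdditive : ∀ {k} → GluedBases k → AdimAdditive k
  gluedBases⇒adimAdditive (AG , AH , bAG , bAH , cross) _ _ _ (SG , bSG , refl) (SH , bSH , refl) (S , bS , refl) = begin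
    ∣ S ∣            ≡⟨ basis-size-unique GH S (AG ++ AH) bS (++-basis AG AH bAG bAH cross) ⟩
    ∣ AG ++ AH ∣     ≡⟨ ∣p++q∣≡∣p∣+∣q∣ AG AH ⟩
    ∣ AG ∣ + ∣ AH ∣  ≡⟨ cong₂ _+_ (basis-size-unique G AG SG bAG bSG) (basis-size-unique H AH SH bAH bSH) ⟩
    ∣ SG ∣ + ∣ SH ∣  ∎
    where open ≡-Reasoning

  -- The two halves of a basis of G ⊕ H are generators of G and H; additivity forces them to be bases.
  adimAdditive⇒gluedBases : ∀ {k} → k ≤𝒞 GH → AdimAdditive k → GluedBases k
  adimAdditive⇒gluedBases {k} k≤𝒞 additive with basis-exists GH ⊤ (≤𝒞⇒⊤-isGenerator GH k≤𝒞)
  ... | S , bS with Vec.splitAt m S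
  ... | SG , SH , refl with Equivalence.to (isGenerator-⊕⇔ k SG SH) (proj₁ bS)
  ... | gG , gH , cross with basis-exists G SG gG | basis-exists H SH gH
  ... | BG , bBG | BH , bBH =
    SG , SH , isGenerator-≤-basis⇒basis G SG BG bBG gG ∣SG∣≤∣BG∣ , isGenerator-≤-basis⇒basis H SH BH bBH gH ∣SH∣≤∣BH∣ , cross
    where
    sizes : ∣ SG ∣ + ∣ SH ∣ ≡ ∣ BG ∣ + ∣ BH ∣
    sizes = trans (≡.sym (∣p++q∣≡∣p∣+∣q∣ SG SH))
                  (additive _ _ _ (BG , bBG , refl) (BH , bBH , refl) (SG ++ SH , bS , refl))
    ∣SG∣≤∣BG∣ : ∣ SG ∣ ≤ ∣ BG ∣
    ∣SG∣≤∣BG∣ = m+n≡o+p∧p≤n⇒m≤o sizes (proj₂ bBH SH gH)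
    ∣SH∣≤∣BH∣ : ∣ SH ∣ ≤ ∣ BH ∣
    ∣SH∣≤∣BH∣ = m+n≡o+p∧p≤n⇒m≤o (trans (+-comm ∣ SH ∣ ∣ SG ∣) (trans sizes (+-comm ∣ BG ∣ ∣ BH ∣))) (proj₂ bBG SG gG)

theorem47 : (G H : Graph) → 2 ≤ order G → 2 ≤ order H →
    (k : ℕ) → 0 < k → k ≤𝒞 (G ⊕ H) →
    (Σ (Subset (order G)) λ AG → Σ (Subset (order H)) λ AH →
       IsBasis k G AG × IsBasis k H AH ×
       (∀ (x : Fin (order G)) (y : Fin (order H)) →
          k ≤ ∣ embedˡ (order H) (AG ─ N G x) ∪ embedʳ (order G) (AH ─ N H y) ∣))
    ⇔
    (∀ (a b c : ℕ) → IsAdim k G a → IsAdim k H b → IsAdim k (G ⊕ H) c → c ≡ a + b)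
theorem47 G H _ _ k _ k≤𝒞 = mk⇔ gluedBases⇒adimAdditive (adimAdditive⇒gluedBases k≤𝒞)
  where open Join G H
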